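{- Let $G$ be a graph and $r\ge 0$ an integer. Let $u,v,w$ be vertices with $uv,vw\in E(G)$ and $u,w$ at distance $2$, and let $X\subseteq V(G)$ be an $r$-local $u$--$w$ separator of $G$ with respect to $v$. Then $X\cap N^{r/2}[v]$ is a $u$--$w$ separator of $B_{r/2}(v)$, i.e., it avoids $u,w$ and every $u$--$w$ path in $B_{r/2}(v)$ meets it.
   Context: $N^{r/2}[v]$ is the set of vertices at distance at most $r/2$ from $v$. $B_{r/2}(v)$ is the subgraph with vertex set $N^{r/2}[v]$ and all edges of $G$ whose endpoints' distances to $v$ sum to strictly less than $r$. For $X\subseteq V(G)$: an $X$-walk is a walk whose first and last vertices lie in $X$ and which otherwise avoids $X$; a walk is $r$-local if it is a walk in a cycle of $G$ of length at most $r$ or a walk traversing a single edge; $\partial X$ is the set of edges with exactly one endpoint in $X$; the $r$-local components at $X$ are the classes of the transitive closure of the relation on $\partial X$ given by $e\sim_r f$ iff $e=f$ or $e,f$ are the first and last edges of an $r$-local $X$-walk. $X$ is an $r$-local $u$--$w$ separator with respect to $v$ (where $uv,vw\in E(G)$ and $u,w$ are at distance 2) if $u,w\notin X$, $v\in X$, and $uv$ and $vw$ lie in distinct $r$-local components at $X$. -}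

module Defs where

open import Level using (0ℓ)
open import Data.Nat using (ℕ; zero; suc; _+_; _*_; _≤_; _<_)
open import Data.Fin using (Fin; toℕ)
open import Data.Fin.Subset using (Subset; _∈_; _∉_)
open import Data.Nat.DivMod using (_%_)
open import Data.List using (List; []; _∷_)
open import Data.List.Relation.Unary.Any using (Any)
open import Data.List.Relation.Unary.Unique.Propositional using (Unique)
open import Data.Product using (Σ; ∃; ∃-syntax; _×_; _,_)
open import Data.Sum using (_⊎_)
open import Data.Unit using (⊤)
open import Data.Empty using (⊥)
open import Function.Definitions using (Injective)
open import Relation.Nullary using (¬_; Dec)
open import Relation.Binary.PropositionalEquality using (_≡_)
open import Relation.Binary.Construct.Closure.Transitive using (TransClosure)

record Graph (n : ℕ) : Set₁ where
  field
    E      : Fin n → Fin n → Set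
    E-dec  : ∀ x y → Dec (E x y)
    E-sym  : ∀ {x y} → E x y → E y x
    E-irr  : ∀ {x} → ¬ E x x

module _ {n : ℕ} (G : Graph n) where
  open Graph G

  V : Set
  V = Fin n

  data Walk : V → V → Set where
    stop : (x : V) → Walk x x
    step : (x : V) {y z : V} → E x y → Walk y z → Walk x z

  len : ∀ {x y} → Walk x y → ℕ
  len (stop _)       = zero
  len (step _ _ w)   = suc (len w)

  verts : ∀ {x y} → Walk x y → List V
  verts (stop x)     = x ∷ []
  verts (step x _ w) = x ∷ verts w

  snoc : ∀ {x y z} → Walk x y → E y z → Walk x z
  snoc (stop x) e       = step x e (stop _)
  snoc (step x e' w) e  = step x e' (snoc w e)

  WalkIn : (P : V → Set) (F : V → V → Set) → ∀ {x y} → Walk x y → Set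
  WalkIn P F (stop x)              = P x
  WalkIn P F (step x {y} _ w)      = P x × F x y × WalkIn P F w

  Avoids : Subset n → ∀ {x y} → Walk x y → Set
  Avoids X (stop x)     = x ∉ X
  Avoids X (step x _ w) = x ∉ X × Avoids X w

  Dist : V → V → ℕ → Set
  Dist x y d = (Σ (Walk x y) λ W → len W ≡ d) × (∀ (W : Walk x y) → d ≤ len W)

  -- Cycles of G: length k = 3 + m, given by an injective map c : Fin k → V,
  -- consecutive vertices (indices i, i+1 mod k) adjacent.
  record Cycle : Set where
    field
      m    : ℕ
      c    : Fin (3 + m) → V
      inj  : Injective _≡_ _≡_ c
      adj  : ∀ i j → toℕ j ≡ suc (toℕ i) % (3 + m) → E (c i) (c j)

    cycLength : ℕ
    cycLength = 3 + m

    OnCycle : V → Set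
    OnCycle x = ∃[ i ] x ≡ c i

    CycEdge : V → V → Set
    CycEdge a b = ∃[ i ] ∃[ j ] (toℕ j ≡ suc (toℕ i) % (3 + m)
                    × ((a ≡ c i × b ≡ c j) ⊎ (a ≡ c j × b ≡ c i)))

  open Cycle public

  InCycle : ∀ {x y} → Walk x y → Cycle → Set
  InCycle W C = WalkIn (OnCycle C) (CycEdge C) W

  SingleEdge : ∀ {x y} → Walk x y → Set
  SingleEdge W = ∃[ a ] ∃[ b ] (E a b ×
    WalkIn (λ x → x ≡ a ⊎ x ≡ b)
           (λ x y → (x ≡ a × y ≡ b) ⊎ (x ≡ b × y ≡ a)) W)

  Local : ℕ → ∀ {x y} → Walk x y → Set
  Local r W = (Σ Cycle λ C → cycLength C ≤ r × InCycle W C) ⊎ SingleEdge W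

  -- A boundary edge of X is represented as an oriented pair (a , b) with a ∈ X, b ∉ X.
  -- LocalXWalk r X a b b' a' : there is an r-local X-walk a b … b' a'
  -- (first edge ab, last edge b'a', interior vertices b … b' avoiding X).
  LocalXWalk : ℕ → Subset n → V → V → V → V → Set
  LocalXWalk r X a b b' a' =
    a ∈ X × a' ∈ X ×
    Σ (E a b) λ e₁ → Σ (E b' a') λ e₂ → Σ (Walk b b') λ W →
      Avoids X W × Local r (step a e₁ (snoc W e₂))

  LocalRel : ℕ → Subset n → V × V → V × V → Set
  LocalRel r X (a , b) (a' , b') =
    (a ≡ a' × b ≡ b') ⊎ LocalXWalk r X a b b' a'

  SameComp : ℕ → Subset n → V × V → V × V → Set
  SameComp r X = TransClosure (LocalRel r X)

  LocalSeparator : ℕ → Subset n → V → V → V → Set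
  LocalSeparator r X u v w =
    u ∉ X × w ∉ X × v ∈ X × ¬ SameComp r X (v , u) (v , w)

  -- N^{r/2}[v] : vertices at distance ≤ r/2 from v (i.e. 2·d ≤ r)
  InBall : ℕ → V → V → Set
  InBall r v x = ∃[ d ] (Dist v x d × 2 * d ≤ r)

  BallEdge : ℕ → V → V → V → Set
  BallEdge r v x y = E x y × ∃[ dx ] ∃[ dy ] (Dist v x dx × Dist v y dy × dx + dy < r)

  IsBallPath : ℕ → V → ∀ {x y} → Walk x y → Set
  IsBallPath r v W = Unique (verts W) × WalkIn (InBall r v) (BallEdge r v) W

  InXBall : ℕ → Subset n → V → V → Set
  InXBall r X v x = x ∈ X × InBall r v x

  BallSeparator : ℕ → Subset n → V → V → V → Set
  BallSeparator r X v u w =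
    ¬ InXBall r X v u × ¬ InXBall r X v w ×
    (∀ (W : Walk u w) → IsBallPath r v W → Any (InXBall r X v) (verts W))

{-# OPTIONS --safe #-}
-- Suppose some u–w walk in B_{r/2}(v) avoids X.  Let K be the r-local component of vu at X
-- (the goal is ⊥, so membership in K may be assumed decidable).  Counting mod 2 the edges of
-- K crossed by a walk gives a parity that vanishes on every closed walk of length ≤ r: such a
-- walk splits into cycles of length ≤ r, and around such a cycle each exit from X pairs with
-- the next re-entry into an r-local X-walk, whose end edges lie in the same component.
-- Hence two v–s walks of total length ≤ r have equal parity.  Along the avoiding walk, the
-- geodesics from v to consecutive vertices s, s' therefore have equal parity, since
-- d(v,s) + 1 + d(v,s') ≤ r and the edge ss' lies outside ∂X.  But the geodesics vu and vw
-- have parities 1 (vu ∈ K) and 0 (vw ∉ K).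
module Submission where

open import Defs
open import Algebra.Bundles using (CommutativeRing)
open import Data.Bool using (Bool; true; false; _xor_)
open import Data.Bool.Properties
  using (xor-assoc; xor-comm; xor-identityʳ; xor-same; xor-∧-commutativeRing)
open import Data.Empty using (⊥; ⊥-elim)
open import Data.Fin using (Fin; toℕ; fromℕ<)
open import Data.Fin.Properties using (toℕ-injective; toℕ<n; toℕ-fromℕ<; _≟_; sequence)
open import Data.Fin.Subset using (Subset; _∈_; _∉_)
open import Data.Fin.Subset.Properties using (_∈?_)
open import Data.List.Membership.Propositional using (find) renaming (_∈_ to _∈ᴸ_)
open import Data.List.Relation.Unary.All using ([])
open import Data.List.Relation.Unary.All.Properties using (¬Any⇒All¬)
open import Data.List.Relation.Unary.AllPairs using ([]; _∷_)
open import Data.List.Relation.Unary.Any using (Any; here; there; any?)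
open import Data.List.Relation.Unary.Unique.Propositional using (Unique)
open import Data.List.Relation.Unary.Unique.Propositional.Properties using (Unique[x∷xs]⇒x∉xs)
open import Data.Nat using (ℕ; zero; suc; _+_; _≤_; _<_; z≤n; s≤s)
open import Data.Nat.DivMod using (_%_; m%n<n; m<n⇒m%n≡m; n%n≡0)
open import Data.Nat.Properties
  using ( +-commutativeSemigroup; ≤-refl; ≤-trans; ≤-pred; m≤n⇒m<n∨m≡n; n≤1+n; m≤n+m; m≤m+n
        ; +-mono-≤; +-monoˡ-≤; +-identityʳ)
open import Data.Product using (Σ; _×_; _,_; proj₁; proj₂)
open import Data.Sum using (_⊎_; inj₁; inj₂)
open import Effect.Monad using (RawMonad)
open import Function using (_∘_)
open import Relation.Binary.Construct.Closure.Transitive using ([_]; _∷ʳ_)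
open import Relation.Binary.PropositionalEquality
open import Relation.Nullary using (¬_; Dec; yes; no; does)
open import Relation.Nullary.Decidable using (dec-true; dec-false; ¬¬-excluded-middle)
open import Relation.Nullary.Negation using (¬¬-Monad)

open import Algebra.Properties.CommutativeSemigroup
  (CommutativeRing.+-commutativeSemigroup xor-∧-commutativeRing)
  using () renaming (x∙yz≈y∙xz to xor-exchange)
open import Algebra.Properties.CommutativeSemigroup +-commutativeSemigroup
  using () renaming (x∙yz≈y∙xz to +-exchange)

xor≡false⇒≡ : ∀ a b → a xor b ≡ false → a ≡ b
xor≡false⇒≡ true  true  _ = refl
xor≡false⇒≡ false false _ = refl

¬¬-decidable₂ : ∀ {m} {P : Fin m → Fin m → Set} → ¬ ¬ (∀ a b → Dec (P a b))
¬¬-decidable₂ = sequence ¬¬-applicative λ _ → sequence ¬¬-applicative λ _ → ¬¬-excluded-middle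
  where open RawMonad ¬¬-Monad using () renaming (rawApplicative to ¬¬-applicative)

module Walks {n : ℕ} (G : Graph n) where
  open Graph G

  infixr 5 _++_
  _++_ : ∀ {a b c} → Walk G a b → Walk G b c → Walk G a c
  stop _     ++ W₂ = W₂
  step x e W₁ ++ W₂ = step x e (W₁ ++ W₂)

  reverse : ∀ {a b} → Walk G a b → Walk G b a
  reverse (stop x)     = stop x
  reverse (step x e W) = snoc G (reverse W) (E-sym e)

  len-++ : ∀ {a b c} (W₁ : Walk G a b) (W₂ : Walk G b c) →
           len G (W₁ ++ W₂) ≡ len G W₁ + len G W₂
  len-++ (stop _)     W₂ = refl
  len-++ (step x e W₁) W₂ = cong suc (len-++ W₁ W₂)

  len-snoc : ∀ {a b c} (W : Walk G a b) (e : E b c) → len G (snoc G W e) ≡ suc (len G W)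
  len-snoc (stop x)      e = refl
  len-snoc (step x e′ W) e = cong suc (len-snoc W e)

  len-reverse : ∀ {a b} (W : Walk G a b) → len G (reverse W) ≡ len G W
  len-reverse (stop x)     = refl
  len-reverse (step x e W) = trans (len-snoc (reverse W) (E-sym e)) (cong suc (len-reverse W))

  reverse-snoc : ∀ {a b c} (W : Walk G a b) (e : E b c) →
                 reverse (snoc G W e) ≡ step c (E-sym e) (reverse W)
  reverse-snoc (stop x)      e = refl
  reverse-snoc (step x e′ W) e = cong (λ W′ → snoc G W′ (E-sym e′)) (reverse-snoc W e)

  Geodesic : ∀ {a b} → Walk G a b → Set
  Geodesic {a} {b} γ = ∀ (W : Walk G a b) → len G γ ≤ len G W

  Dist⇒geodesic : ∀ {a b d} → Dist G a b d → Σ (Walk G a b) λ γ → Geodesic γ × len G γ ≡ d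
  Dist⇒geodesic ((γ , refl) , minimal) = γ , minimal , refl

  geodesic-≤-Dist : ∀ {a b d} {γ : Walk G a b} → Geodesic γ → Dist G a b d → len G γ ≤ d
  geodesic-≤-Dist γ-geodesic ((W , refl) , _) = γ-geodesic W

  edge-geodesic : ∀ {a b} → ¬ a ≡ b → (e : E a b) → Geodesic (step a e (stop b))
  edge-geodesic a≢b e (stop _)       = ⊥-elim (a≢b refl)
  edge-geodesic a≢b e (step _ _ _) = s≤s z≤n

  module _ {P : Fin n → Set} {F : Fin n → Fin n → Set} where

    WalkIn-head : ∀ {a b} (W : Walk G a b) → WalkIn G P F W → P a
    WalkIn-head (stop _)     Pa         = Pa
    WalkIn-head (step _ _ _) (Pa , _) = Pa

    WalkIn-++⁻ : ∀ {a b c} (W₁ : Walk G a b) (W₂ : Walk G b c) →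
                 WalkIn G P F (W₁ ++ W₂) → WalkIn G P F W₁ × WalkIn G P F W₂
    WalkIn-++⁻ (stop _)      W₂ in₂ = WalkIn-head W₂ in₂ , in₂
    WalkIn-++⁻ (step x e W₁) W₂ (Px , Fxy , in₁₂) =
      let in₁ , in₂ = WalkIn-++⁻ W₁ W₂ in₁₂ in (Px , Fxy , in₁) , in₂

    WalkIn-++⁺ : ∀ {a b c} (W₁ : Walk G a b) (W₂ : Walk G b c) →
                 WalkIn G P F W₁ → WalkIn G P F W₂ → WalkIn G P F (W₁ ++ W₂)
    WalkIn-++⁺ (stop _)      W₂ _                 in₂ = in₂
    WalkIn-++⁺ (step x e W₁) W₂ (Px , Fxy , in₁) in₂ = Px , Fxy , WalkIn-++⁺ W₁ W₂ in₁ in₂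

    WalkIn-snoc : ∀ {a b c} (W : Walk G a b) (e : E b c) →
                  WalkIn G P F W → F b c → P c → WalkIn G P F (snoc G W e)
    WalkIn-snoc (stop x)      e Px              Fxc Pc = Px , Fxc , Pc
    WalkIn-snoc (step x e′ W) e (Px , Fxy , inW) Fbc Pc = Px , Fxy , WalkIn-snoc W e inW Fbc Pc

    WalkIn-reverse : (∀ {x y} → F x y → F y x) →
                     ∀ {a b} (W : Walk G a b) → WalkIn G P F W → WalkIn G P F (reverse W)
    WalkIn-reverse F-sym (stop x)     Px              = Px
    WalkIn-reverse F-sym (step x e W) (Px , Fxy , inW) =
      WalkIn-snoc (reverse W) (E-sym e) (WalkIn-reverse F-sym W inW) (F-sym Fxy) Px

  CycEdge-sym : ∀ {C : Cycle G} {a b} → CycEdge C a b → CycEdge C b a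
  CycEdge-sym (i , j , j≡i+1 , inj₁ (a≡cᵢ , b≡cⱼ)) = i , j , j≡i+1 , inj₂ (b≡cⱼ , a≡cᵢ)
  CycEdge-sym (i , j , j≡i+1 , inj₂ (a≡cⱼ , b≡cᵢ)) = i , j , j≡i+1 , inj₁ (b≡cᵢ , a≡cⱼ)

  module _ (X : Subset n) where

    Avoids-head : ∀ {a b} (W : Walk G a b) → Avoids G X W → a ∉ X
    Avoids-head (stop _)     a∉X       = a∉X
    Avoids-head (step _ _ _) (a∉X , _) = a∉X

    Avoids-last : ∀ {a b} (W : Walk G a b) → Avoids G X W → b ∉ X
    Avoids-last (stop _)     b∉X         = b∉X
    Avoids-last (step _ _ W) (_ , W-avoids) = Avoids-last W W-avoids

    Avoids-snoc : ∀ {a b c} (W : Walk G a b) (e : E b c) →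
                  Avoids G X W → c ∉ X → Avoids G X (snoc G W e)
    Avoids-snoc (stop x)      e x∉X             c∉X = x∉X , c∉X
    Avoids-snoc (step x e′ W) e (x∉X , W-avoids) c∉X = x∉X , Avoids-snoc W e W-avoids c∉X

    Avoids-reverse : ∀ {a b} (W : Walk G a b) → Avoids G X W → Avoids G X (reverse W)
    Avoids-reverse (stop x)     x∉X             = x∉X
    Avoids-reverse (step x e W) (x∉X , W-avoids) =
      Avoids-snoc (reverse W) (E-sym e) (Avoids-reverse W W-avoids) x∉X

    visits⊎avoids : ∀ {P F a b} (W : Walk G a b) → WalkIn G P F W →
                    Any (λ x → x ∈ X × P x) (verts G W) ⊎ Avoids G X W
    visits⊎avoids (stop x) Px with x ∈? X
    ... | yes x∈X = inj₁ (here (x∈X , Px))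
    ... | no  x∉X = inj₂ x∉X
    visits⊎avoids (step x e W) (Px , _ , inW) with x ∈? X | visits⊎avoids W inW
    ... | yes x∈X | _              = inj₁ (here (x∈X , Px))
    ... | no  _   | inj₁ visits    = inj₁ (there visits)
    ... | no  x∉X | inj₂ W-avoids = inj₂ (x∉X , W-avoids)

    record FirstEntry {t a} (W : Walk G t a) : Set where
      constructor first-entry
      field
        {last-out first-in} : Fin n
        outside   : Walk G t last-out
        entering  : E last-out first-in
        rest      : Walk G first-in a
        outside-avoids : Avoids G X outside
        first-in∈X     : first-in ∈ X
        split          : W ≡ snoc G outside entering ++ rest

    inside⊎firstEntry : ∀ {t a} (W : Walk G t a) → a ∈ X → t ∈ X ⊎ FirstEntry W
    inside⊎firstEntry {t} W a∈X with t ∈? X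
    ... | yes t∈X = inj₁ t∈X
    inside⊎firstEntry (stop t) t∈X | no t∉X = ⊥-elim (t∉X t∈X)
    inside⊎firstEntry (step t e W) a∈X | no t∉X with inside⊎firstEntry W a∈X
    ... | inj₁ s∈X = inj₂ (first-entry (stop t) e W t∉X s∈X refl)
    ... | inj₂ (first-entry M e′ R M-avoids b∈X refl) =
          inj₂ (first-entry (step t e M) e′ R (t∉X , M-avoids) b∈X refl)

  -- Junk value: positions past the end give the last vertex.
  vertAt : ∀ {a b} → Walk G a b → ℕ → Fin n
  vertAt (stop x)     _       = x
  vertAt (step x e W) zero    = x
  vertAt (step x e W) (suc t) = vertAt W t

  vertAt-0 : ∀ {a b} (W : Walk G a b) → vertAt W 0 ≡ a
  vertAt-0 (stop x)     = refl
  vertAt-0 (step x e W) = refl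

  vertAt-len : ∀ {a b} (W : Walk G a b) → vertAt W (len G W) ≡ b
  vertAt-len (stop x)     = refl
  vertAt-len (step x e W) = vertAt-len W

  vertAt-edge : ∀ {a b} (W : Walk G a b) t → t < len G W → E (vertAt W t) (vertAt W (suc t))
  vertAt-edge (step x e W) zero    _         = subst (E x) (sym (vertAt-0 W)) e
  vertAt-edge (step x e W) (suc t) (s≤s t<) = vertAt-edge W t t<

  vertAt-∈ : ∀ {a b} (W : Walk G a b) {t} → t ≤ len G W → vertAt W t ∈ᴸ verts G W
  vertAt-∈ (stop x)     _                = here refl
  vertAt-∈ (step x e W) {zero}  _        = here refl
  vertAt-∈ (step x e W) {suc t} (s≤s t≤) = there (vertAt-∈ W t≤)

  vertAt-injective : ∀ {a b} (W : Walk G a b) → Unique (verts G W) → ∀ {s t} →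
                     s ≤ len G W → t ≤ len G W → vertAt W s ≡ vertAt W t → s ≡ t
  vertAt-injective (stop x)     _ z≤n z≤n _ = refl
  vertAt-injective (step x e W) _ {zero}  {zero}  _ _ _ = refl
  vertAt-injective (step x e W) W-path {zero} {suc t} _ (s≤s t≤) x≡Wₜ =
    ⊥-elim (Unique[x∷xs]⇒x∉xs W-path (subst (_∈ᴸ verts G W) (sym x≡Wₜ) (vertAt-∈ W t≤)))
  vertAt-injective (step x e W) W-path {suc s} {zero} (s≤s s≤) _ Wₛ≡x =
    ⊥-elim (Unique[x∷xs]⇒x∉xs W-path (subst (_∈ᴸ verts G W) Wₛ≡x (vertAt-∈ W s≤)))
  vertAt-injective (step x e W) (_ ∷ W-path) {suc s} {suc t} (s≤s s≤) (s≤s t≤) Wₛ≡Wₜ =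
    cong suc (vertAt-injective W W-path s≤ t≤ Wₛ≡Wₜ)

  vertAt-snoc : ∀ {a b c} (W : Walk G a b) (e : E b c) {t} → t ≤ len G W →
                vertAt (snoc G W e) t ≡ vertAt W t
  vertAt-snoc (stop x)      e z≤n = refl
  vertAt-snoc (step x e′ W) e {zero}  _        = refl
  vertAt-snoc (step x e′ W) e {suc t} (s≤s t≤) = vertAt-snoc W e t≤

  WalkIn-from-vertAt : ∀ {P F a b} (W : Walk G a b) →
                       (∀ t → t ≤ len G W → P (vertAt W t)) →
                       (∀ t → t < len G W → F (vertAt W t) (vertAt W (suc t))) →
                       WalkIn G P F W
  WalkIn-from-vertAt (stop x) on _ = on 0 z≤n
  WalkIn-from-vertAt {F = F} (step x e W) on along =
    on 0 z≤n ,
    subst (F x) (vertAt-0 W) (along 0 (s≤s z≤n)) ,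
    WalkIn-from-vertAt W (λ t → on (suc t) ∘ s≤s) (λ t → along (suc t) ∘ s≤s)

  split-at : ∀ {a b x} (W : Walk G a b) → x ∈ᴸ verts G W →
             Σ (Walk G a x) λ W₁ → Σ (Walk G x b) λ W₂ → W ≡ W₁ ++ W₂
  split-at (stop a)     (here refl) = stop a , stop a , refl
  split-at (step a e W) (here refl) = stop a , step a e W , refl
  split-at (step a e W) (there x∈W) with split-at W x∈W
  ... | W₁ , W₂ , refl = step a e W₁ , W₂ , refl

  record Detour {a b} (W : Walk G a b) : Set where
    constructor detour
    field
      {pivot} : Fin n
      before  : Walk G a pivot
      loop    : Walk G pivot pivot
      after   : Walk G pivot b
      loop-nonempty : 1 ≤ len G loop
      split   : W ≡ before ++ loop ++ after

  len-excise : ∀ {a b c} (W₁ : Walk G a b) (L : Walk G b b) (W₂ : Walk G b c) →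
               len G (W₁ ++ L ++ W₂) ≡ len G L + len G (W₁ ++ W₂)
  len-excise W₁ L W₂ = begin
    len G (W₁ ++ L ++ W₂)               ≡⟨ trans (len-++ W₁ _) (cong (len G W₁ +_) (len-++ L W₂)) ⟩
    len G W₁ + (len G L + len G W₂)     ≡⟨ +-exchange (len G W₁) (len G L) (len G W₂) ⟩
    len G L + (len G W₁ + len G W₂)     ≡⟨ cong (len G L +_) (sym (len-++ W₁ W₂)) ⟩
    len G L + len G (W₁ ++ W₂)          ∎
    where open ≡-Reasoning

  path⊎detour : ∀ {a b} (W : Walk G a b) → Unique (verts G W) ⊎ Detour W
  path⊎detour (stop a) = inj₁ ([] ∷ [])
  path⊎detour (step a e W) with path⊎detour W
  ... | inj₂ (detour W₁ L W₂ L≢0 refl) = inj₂ (detour (step a e W₁) L W₂ L≢0 refl)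
  ... | inj₁ W-path with any? (a ≟_) (verts G W)
  ...   | no  a∉W = inj₁ (¬Any⇒All¬ (verts G W) a∉W ∷ W-path)
  ...   | yes a∈W with split-at W a∈W
  ...     | W₁ , W₂ , refl = inj₂ (detour (stop a) (step a e W₁) W₂ (s≤s z≤n) refl)

-- The cycle runs through the vertices of the path P in order and closes up along e; a
-- position t on the closed walk corresponds to the cycle index t mod (3 + m).
module SimpleCycle {n : ℕ} (G : Graph n) {x y : Fin n} (e : Graph.E G x y) (P : Walk G y x)
                   (P-path : Unique (verts G P)) {m : ℕ} (len-P : len G P ≡ 2 + m) where
  open Graph G
  open Walks G

  closed : Walk G y y
  closed = snoc G P e

  private
    len-closed : len G closed ≡ 3 + m
    len-closed = trans (len-snoc P e) (cong suc len-P)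

    vertex : Fin (3 + m) → Fin n
    vertex i = vertAt P (toℕ i)

    toℕ≤len-P : ∀ {t} → t < 3 + m → t ≤ len G P
    toℕ≤len-P {t} t<3+m = subst (t ≤_) (sym len-P) (≤-pred t<3+m)

    vertex-injective : ∀ {i j} → vertex i ≡ vertex j → i ≡ j
    vertex-injective {i} {j} =
      toℕ-injective ∘ vertAt-injective P P-path (toℕ≤len-P (toℕ<n i)) (toℕ≤len-P (toℕ<n j))

    position : ℕ → Fin (3 + m)
    position t = fromℕ< (m%n<n t (3 + m))

    vertAt-closed-mod : ∀ t → t ≤ 3 + m → vertAt closed t ≡ vertAt closed (t % (3 + m))
    vertAt-closed-mod t t≤3+m with m≤n⇒m<n∨m≡n t≤3+m
    ... | inj₁ t<3+m = cong (vertAt closed) (sym (m<n⇒m%n≡m t<3+m))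
    ... | inj₂ refl  = begin
      vertAt closed (3 + m)         ≡⟨ cong (vertAt closed) (sym len-closed) ⟩
      vertAt closed (len G closed)  ≡⟨ vertAt-len closed ⟩
      y                             ≡⟨ sym (vertAt-0 closed) ⟩
      vertAt closed 0               ≡⟨ cong (vertAt closed) (sym (n%n≡0 (3 + m))) ⟩
      vertAt closed ((3 + m) % (3 + m)) ∎
      where open ≡-Reasoning

    vertAt-closed : ∀ t → t ≤ 3 + m → vertAt closed t ≡ vertex (position t)
    vertAt-closed t t≤3+m = begin
      vertAt closed t                 ≡⟨ vertAt-closed-mod t t≤3+m ⟩
      vertAt closed (t % (3 + m))     ≡⟨ vertAt-snoc P e (toℕ≤len-P (m%n<n t (3 + m))) ⟩
      vertAt P (t % (3 + m))          ≡⟨ cong (vertAt P) (sym (toℕ-fromℕ< _)) ⟩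
      vertex (position t)             ∎
      where open ≡-Reasoning

    position-toℕ : ∀ t (j : Fin (3 + m)) → toℕ j ≡ t % (3 + m) → position t ≡ j
    position-toℕ t j j≡t = toℕ-injective (trans (toℕ-fromℕ< _) (sym j≡t))

    vertex-adjacent : ∀ i j → toℕ j ≡ suc (toℕ i) % (3 + m) → E (vertex i) (vertex j)
    vertex-adjacent i j j≡i+1 = subst₂ E
      (vertAt-snoc P e (toℕ≤len-P (toℕ<n i)))
      (trans (vertAt-closed (suc (toℕ i)) (toℕ<n i)) (cong vertex (position-toℕ (suc (toℕ i)) j j≡i+1)))
      (vertAt-edge closed (toℕ i) (subst (toℕ i <_) (sym len-closed) (toℕ<n i)))

  cycle : Cycle G
  cycle = record { m = m ; c = vertex ; inj = vertex-injective ; adj = vertex-adjacent }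

  closed-in-cycle : InCycle G closed cycle
  closed-in-cycle = WalkIn-from-vertAt closed on along
    where
      bound : ∀ {t} → t ≤ len G closed → t ≤ 3 + m
      bound {t} = subst (t ≤_) len-closed

      on : ∀ t → t ≤ len G closed → OnCycle cycle (vertAt closed t)
      on t t≤ = position t , vertAt-closed t (bound t≤)

      along : ∀ t → t < len G closed → CycEdge cycle (vertAt closed t) (vertAt closed (suc t))
      along t t< = position t , position (suc t) , successor ,
                   inj₁ (vertAt-closed t (bound (≤-trans (n≤1+n t) t<)) , vertAt-closed (suc t) (bound t<))
        where
          successor : toℕ (position (suc t)) ≡ suc (toℕ (position t)) % (3 + m)
          successor = trans (toℕ-fromℕ< _)
            (cong (λ s → suc s % (3 + m)) (sym (trans (toℕ-fromℕ< _) (m<n⇒m%n≡m (bound t<)))))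

module Crossings {n : ℕ} (G : Graph n) (X : Subset n) (f : Fin n → Fin n → Bool) where
  open Graph G
  open Walks G

  crossing : Fin n → Fin n → Bool
  crossing x y with x ∈? X | y ∈? X
  ... | yes _ | no _  = f x y
  ... | no _  | yes _ = f y x
  ... | _     | _     = false

  crossing-sym : ∀ x y → crossing x y ≡ crossing y x
  crossing-sym x y with x ∈? X | y ∈? X
  ... | yes _ | yes _ = refl
  ... | yes _ | no _  = refl
  ... | no _  | yes _ = refl
  ... | no _  | no _  = refl

  crossing-exit : ∀ {x y} → x ∈ X → y ∉ X → crossing x y ≡ f x y
  crossing-exit {x} {y} x∈X y∉X with x ∈? X | y ∈? X
  ... | yes _   | no _    = refl
  ... | no x∉X  | _       = ⊥-elim (x∉X x∈X)
  ... | yes _   | yes y∈X = ⊥-elim (y∉X y∈X)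

  crossing-entry : ∀ {x y} → x ∉ X → y ∈ X → crossing x y ≡ f y x
  crossing-entry {x} {y} x∉X y∈X = trans (crossing-sym x y) (crossing-exit y∈X x∉X)

  crossing-inside : ∀ {x y} → x ∈ X → y ∈ X → crossing x y ≡ false
  crossing-inside {x} {y} x∈X y∈X with x ∈? X | y ∈? X
  ... | yes _  | yes _   = refl
  ... | no x∉X | _       = ⊥-elim (x∉X x∈X)
  ... | yes _  | no y∉X  = ⊥-elim (y∉X y∈X)

  crossing-outside : ∀ {x y} → x ∉ X → y ∉ X → crossing x y ≡ false
  crossing-outside {x} {y} x∉X y∉X with x ∈? X | y ∈? X
  ... | no _    | no _    = refl
  ... | yes x∈X | _       = ⊥-elim (x∉X x∈X)
  ... | no _    | yes y∈X = ⊥-elim (y∉X y∈X)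

  parity : ∀ {a b} → Walk G a b → Bool
  parity (stop _)         = false
  parity (step x {y} _ W) = crossing x y xor parity W

  parity-++ : ∀ {a b c} (W₁ : Walk G a b) (W₂ : Walk G b c) →
              parity (W₁ ++ W₂) ≡ parity W₁ xor parity W₂
  parity-++ (stop _)          W₂ = refl
  parity-++ (step x {y} e W₁) W₂ =
    trans (cong (crossing x y xor_) (parity-++ W₁ W₂)) (sym (xor-assoc (crossing x y) _ _))

  parity-snoc : ∀ {a b c} (W : Walk G a b) (e : E b c) →
                parity (snoc G W e) ≡ parity W xor crossing b c
  parity-snoc (stop x)           e = xor-identityʳ _
  parity-snoc (step x {y} e′ W) e =
    trans (cong (crossing x y xor_) (parity-snoc W e)) (sym (xor-assoc (crossing x y) _ _))

  parity-step≡parity-snoc : ∀ {a b} (e : E a b) (W : Walk G b a) →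
                            parity (step a e W) ≡ parity (snoc G W e)
  parity-step≡parity-snoc {a} {b} e W =
    trans (xor-comm (crossing a b) (parity W)) (sym (parity-snoc W e))

  parity-reverse : ∀ {a b} (W : Walk G a b) → parity (reverse W) ≡ parity W
  parity-reverse (stop x)         = refl
  parity-reverse (step x {y} e W) = begin
    parity (snoc G (reverse W) (E-sym e))  ≡⟨ parity-snoc (reverse W) (E-sym e) ⟩
    parity (reverse W) xor crossing y x    ≡⟨ cong (_xor crossing y x) (parity-reverse W) ⟩
    parity W xor crossing y x              ≡⟨ cong (parity W xor_) (crossing-sym y x) ⟩
    parity W xor crossing x y              ≡⟨ xor-comm (parity W) (crossing x y) ⟩
    crossing x y xor parity W              ∎
    where open ≡-Reasoning

  parity-rotate : ∀ {a b} (A : Walk G a b) (B : Walk G b a) → parity (A ++ B) ≡ parity (B ++ A)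
  parity-rotate A B = begin
    parity (A ++ B)           ≡⟨ parity-++ A B ⟩
    parity A xor parity B     ≡⟨ xor-comm (parity A) (parity B) ⟩
    parity B xor parity A     ≡⟨ sym (parity-++ B A) ⟩
    parity (B ++ A)           ∎
    where open ≡-Reasoning

  parity-excise : ∀ {a b c} (W₁ : Walk G a b) (L : Walk G b b) (W₂ : Walk G b c) →
                  parity (W₁ ++ L ++ W₂) ≡ parity L xor parity (W₁ ++ W₂)
  parity-excise W₁ L W₂ = begin
    parity (W₁ ++ L ++ W₂)             ≡⟨ trans (parity-++ W₁ _) (cong (parity W₁ xor_) (parity-++ L W₂)) ⟩
    p₁ xor (parity L xor p₂)           ≡⟨ xor-exchange p₁ (parity L) p₂ ⟩
    parity L xor (p₁ xor p₂)           ≡⟨ cong (parity L xor_) (sym (parity-++ W₁ W₂)) ⟩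
    parity L xor parity (W₁ ++ W₂)     ∎
    where
      open ≡-Reasoning
      p₁ p₂ : Bool
      p₁ = parity W₁
      p₂ = parity W₂

  parity-avoids : ∀ {a b} (W : Walk G a b) → Avoids G X W → parity W ≡ false
  parity-avoids (stop x)     _                = refl
  parity-avoids (step x e W) (x∉X , W-avoids) =
    cong₂ _xor_ (crossing-outside x∉X (Avoids-head X W W-avoids)) (parity-avoids W W-avoids)

  parity-excursion : ∀ {a t b a′} → a ∈ X → a′ ∈ X →
                     (e : E a t) (M : Walk G t b) (e′ : E b a′) → Avoids G X M →
                     f a t ≡ f a′ b → parity (step a e (snoc G M e′)) ≡ false
  parity-excursion {a} {t} {b} {a′} a∈X a′∈X e M e′ M-avoids same-label = begin
    crossing a t xor parity (snoc G M e′)         ≡⟨ cong (crossing a t xor_) (parity-snoc M e′) ⟩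
    crossing a t xor (parity M xor crossing b a′)
      ≡⟨ cong₂ _xor_ (crossing-exit a∈X (Avoids-head X M M-avoids))
                     (cong₂ _xor_ (parity-avoids M M-avoids) (crossing-entry (Avoids-last X M M-avoids) a′∈X)) ⟩
    f a t xor f a′ b                              ≡⟨ cong (f a t xor_) (sym same-label) ⟩
    f a t xor f a t                               ≡⟨ xor-same (f a t) ⟩
    false                                         ∎
    where open ≡-Reasoning

RespectsLocalWalks : ∀ {n} → Graph n → ℕ → Subset n → (Fin n → Fin n → Bool) → Set
RespectsLocalWalks G r X f =
  ∀ {a t b a′} → LocalXWalk G r X a t b a′ → LocalXWalk G r X a′ b t a → f a t ≡ f a′ b

module LocalParity {n : ℕ} (G : Graph n) (r : ℕ) (X : Subset n)
                   {f : Fin n → Fin n → Bool} (f-respects : RespectsLocalWalks G r X f) where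
  open Graph G
  open Walks G
  open Crossings G X f

  module _ (C : Cycle G) (C≤r : cycLength C ≤ r) where

    parity-along-cycle : ∀ k {a a′} (W : Walk G a a′) → len G W ≤ k → a ∈ X → a′ ∈ X →
                         InCycle G W C → parity W ≡ false
    parity-along-cycle _ (stop _) _ _ _ _ = refl
    parity-along-cycle (suc k) (step a {t} e W) (s≤s W≤k) a∈X a′∈X (a-on , at-on , W-on)
      with inside⊎firstEntry X W a′∈X
    ... | inj₁ t∈X =
      cong₂ _xor_ (crossing-inside a∈X t∈X) (parity-along-cycle k W W≤k t∈X a′∈X W-on)
    ... | inj₂ (first-entry M e′ R M-avoids b∈X refl) =
      trans (parity-++ excursion R)
            (cong₂ _xor_ (parity-excursion a∈X b∈X e M e′ M-avoids (f-respects out back))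
                         (parity-along-cycle k R R≤k b∈X a′∈X R-on))
      where
        excursion : Walk G a _
        excursion = step a e (snoc G M e′)
        excursion-on : InCycle G excursion C
        excursion-on = a-on , at-on , proj₁ (WalkIn-++⁻ (snoc G M e′) R W-on)
        R-on : InCycle G R C
        R-on = proj₂ (WalkIn-++⁻ (snoc G M e′) R W-on)
        R≤k : len G R ≤ k
        R≤k = ≤-trans (subst (len G R ≤_) (sym (len-++ (snoc G M e′) R)) (m≤n+m _ _)) W≤k
        out : LocalXWalk G r X a t _ _
        out = a∈X , b∈X , e , e′ , M , M-avoids , inj₁ (C , C≤r , excursion-on)
        back : LocalXWalk G r X _ _ t a
        back = b∈X , a∈X , E-sym e′ , E-sym e , reverse M , Avoids-reverse X M M-avoids ,
               inj₁ (C , C≤r , subst (λ W′ → InCycle G (snoc G W′ (E-sym e)) C) (reverse-snoc M e′)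
                                     (WalkIn-reverse (CycEdge-sym {C}) excursion excursion-on))

    parity-around-cycle : ∀ {a} (Z : Walk G a a) → InCycle G Z C → parity Z ≡ false
    parity-around-cycle Z Z-on with visits⊎avoids X Z Z-on
    ... | inj₂ Z-avoids = parity-avoids Z Z-avoids
    ... | inj₁ visits with find visits
    ... | b , b∈Z , b∈X , _ with split-at Z b∈Z
    ... | A , B , refl = trans (parity-rotate A B)
      (parity-along-cycle _ (B ++ A) ≤-refl b∈X b∈X
        (WalkIn-++⁺ B A (proj₂ (WalkIn-++⁻ A B Z-on)) (proj₁ (WalkIn-++⁻ A B Z-on))))

  parity-closed-path : ∀ {x y} (e : E x y) (P : Walk G y x) → Unique (verts G P) →
                       suc (len G P) ≤ r → parity (step x e P) ≡ false
  parity-closed-path e (stop _) _ _ = ⊥-elim (E-irr e)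
  parity-closed-path {x} {y} e (step _ _ (stop _)) _ _ =
    trans (cong (crossing x y xor_) (trans (xor-identityʳ _) (crossing-sym y x))) (xor-same (crossing x y))
  parity-closed-path e P@(step _ _ (step _ _ P″)) P-path P<r =
    trans (parity-step≡parity-snoc e P) (parity-around-cycle cycle P<r closed closed-in-cycle)
    where open SimpleCycle G e P P-path {len G P″} refl

  parity-short-closed : ∀ {x} (Z : Walk G x x) → len G Z ≤ r → parity Z ≡ false
  parity-short-closed Z = bounded (len G Z) Z ≤-refl
    where
      bounded : ∀ k {x} (Z : Walk G x x) → len G Z ≤ k → len G Z ≤ r → parity Z ≡ false
      bounded _ (stop _) _ _ = refl
      bounded (suc k) (step x e P) (s≤s P≤k) Z≤r with path⊎detour P
      ... | inj₁ P-path = parity-closed-path e P P-path Z≤r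
      ... | inj₂ (detour W₁ L W₂ L≢0 refl) = begin
        parity (step x e (W₁ ++ L ++ W₂))            ≡⟨ parity-excise (step x e W₁) L W₂ ⟩
        parity L xor parity (step x e (W₁ ++ W₂))
          ≡⟨ cong₂ _xor_ (bounded k L (≤-trans L≤P P≤k) (≤-trans L≤P P≤r))
                         (bounded k (step x e (W₁ ++ W₂)) (≤-trans rest≤P P≤k) (≤-trans rest≤P P≤r)) ⟩
        false                                        ∎
        where
          open ≡-Reasoning
          P≤r : len G (W₁ ++ L ++ W₂) ≤ r
          P≤r = ≤-trans (n≤1+n _) Z≤r
          L≤P : len G L ≤ len G (W₁ ++ L ++ W₂)
          L≤P = subst (len G L ≤_) (sym (len-excise W₁ L W₂)) (m≤m+n _ _)
          rest≤P : suc (len G (W₁ ++ W₂)) ≤ len G (W₁ ++ L ++ W₂)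
          rest≤P = subst (_ ≤_) (sym (len-excise W₁ L W₂)) (+-monoˡ-≤ _ L≢0)

  parity-short-pair : ∀ {a b} (γ₁ γ₂ : Walk G a b) → len G γ₁ + len G γ₂ ≤ r →
                      parity γ₁ ≡ parity γ₂
  parity-short-pair γ₁ γ₂ γ₁+γ₂≤r = xor≡false⇒≡ _ _ (begin
    parity γ₁ xor parity γ₂              ≡⟨ cong (parity γ₁ xor_) (sym (parity-reverse γ₂)) ⟩
    parity γ₁ xor parity (reverse γ₂)    ≡⟨ sym (parity-++ γ₁ (reverse γ₂)) ⟩
    parity (γ₁ ++ reverse γ₂)            ≡⟨ parity-short-closed _ (subst (_≤ r) len-loop γ₁+γ₂≤r) ⟩
    false                                ∎)
    where
      open ≡-Reasoning
      len-loop : len G γ₁ + len G γ₂ ≡ len G (γ₁ ++ reverse γ₂)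
      len-loop = sym (trans (len-++ γ₁ _) (cong (len G γ₁ +_) (len-reverse γ₂)))

  geodesic-parity : ∀ {v s t} (P : Walk G s t) → WalkIn G (InBall G r v) (BallEdge G r v) P →
                    Avoids G X P → (γ : Walk G v s) (δ : Walk G v t) →
                    Geodesic γ → Geodesic δ → parity γ ≡ parity δ
  geodesic-parity (stop s) (d , v-s , 2d≤r) _ γ δ γ-geodesic δ-geodesic =
    parity-short-pair γ δ
      (≤-trans (+-mono-≤ (geodesic-≤-Dist γ-geodesic v-s) (geodesic-≤-Dist δ-geodesic v-s))
               (subst (λ d′ → d + d′ ≤ r) (+-identityʳ d) 2d≤r))
  geodesic-parity (step s {s′} e P) (_ , (_ , d , d′ , v-s , v-s′ , d+d′<r) , P-in) (s∉X , P-avoids)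
                  γ δ γ-geodesic δ-geodesic
    with Dist⇒geodesic v-s′
  ... | γ′ , γ′-geodesic , refl = begin
    parity γ                     ≡⟨ sym (xor-identityʳ _) ⟩
    parity γ xor false           ≡⟨ cong (parity γ xor_) (sym (crossing-outside s∉X s′∉X)) ⟩
    parity γ xor crossing s s′   ≡⟨ sym (parity-snoc γ e) ⟩
    parity (snoc G γ e)          ≡⟨ parity-short-pair (snoc G γ e) γ′ γe+γ′≤r ⟩
    parity γ′                    ≡⟨ geodesic-parity P P-in P-avoids γ′ δ γ′-geodesic δ-geodesic ⟩
    parity δ                     ∎
    where
      open ≡-Reasoning
      s′∉X : s′ ∉ X
      s′∉X = Avoids-head X P P-avoids
      γe+γ′≤r : len G (snoc G γ e) + len G γ′ ≤ r
      γe+γ′≤r = subst (λ l → l + len G γ′ ≤ r) (sym (len-snoc γ e))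
                  (≤-trans (+-monoˡ-≤ (len G γ′) (s≤s (geodesic-≤-Dist γ-geodesic v-s))) d+d′<r)

module ComponentIndicator {n : ℕ} (G : Graph n) (r : ℕ) (X : Subset n) (p : Fin n × Fin n)
                          (same? : ∀ a b → Dec (SameComp G r X p (a , b))) where

  indicator : Fin n → Fin n → Bool
  indicator a b = does (same? a b)

  indicator-respects : RespectsLocalWalks G r X indicator
  indicator-respects {a} {t} {b} {a′} out back with same? a t | same? a′ b
  ... | yes _     | yes _     = refl
  ... | no _      | no _      = refl
  ... | yes p~at  | no p≁a′b  = ⊥-elim (p≁a′b (p~at ∷ʳ inj₂ out))
  ... | no p≁at   | yes p~a′b = ⊥-elim (p≁at (p~a′b ∷ʳ inj₂ back))

ball-walk-meets-separator : ∀ {n} (G : Graph n) (r : ℕ) (X : Subset n) {u v w} →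
  Graph.E G u v → Graph.E G v w → LocalSeparator G r X u v w →
  (W : Walk G u w) → WalkIn G (InBall G r v) (BallEdge G r v) W → ¬ Avoids G X W
ball-walk-meets-separator G r X {u} {v} {w} uv vw (u∉X , w∉X , v∈X , u≁w) W W-in-ball W-avoids =
  ¬¬-decidable₂ contradiction
  where
    open Graph G
    open Walks G

    contradiction : (∀ a b → Dec (SameComp G r X (v , u) (a , b))) → ⊥
    contradiction same? = true≢false (begin
      true                         ≡⟨ sym (dec-true (same? v u) [ inj₁ (refl , refl) ]) ⟩
      indicator v u                ≡⟨ sym (crossing-exit v∈X u∉X) ⟩
      crossing v u                 ≡⟨ sym (xor-identityʳ _) ⟩
      parity (step v vu (stop u))
        ≡⟨ geodesic-parity W W-in-ball W-avoids (step v vu (stop u)) (step v vw (stop w))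
             (edge-geodesic (λ { refl → u∉X v∈X }) vu) (edge-geodesic (λ { refl → w∉X v∈X }) vw) ⟩
      parity (step v vw (stop w))  ≡⟨ xor-identityʳ _ ⟩
      crossing v w                 ≡⟨ crossing-exit v∈X w∉X ⟩
      indicator v w                ≡⟨ dec-false (same? v w) u≁w ⟩
      false                        ∎)
      where
        open ≡-Reasoning
        open ComponentIndicator G r X (v , u) same?
        open Crossings G X indicator
        open LocalParity G r X indicator-respects

        vu : E v u
        vu = E-sym uv

        true≢false : true ≡ false → ⊥
        true≢false ()

lemma3p1 : {n : ℕ} (G : Graph n) (r : ℕ) (u v w : V G) (X : Subset n) →
    Graph.E G u v → Graph.E G v w → Dist G u w 2 →
    LocalSeparator G r X u v w →
    BallSeparator G r X v u w
lemma3p1 G r u v w X uv vw _ separator@(u∉X , w∉X , _ , _) =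
  u∉X ∘ proj₁ , w∉X ∘ proj₁ , meets
  where
    meets : ∀ (W : Walk G u w) → IsBallPath G r v W → Any (InXBall G r X v) (verts G W)
    meets W (_ , W-in-ball) with Walks.visits⊎avoids G X W W-in-ball
    ... | inj₁ visits   = visits
    ... | inj₂ W-avoids =
      ⊥-elim (ball-walk-meets-separator G r X uv vw separator W W-in-ball W-avoids)
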